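{- Let $F(t)=\sum_{n\ge1}\#\mathrm{CNCB}(n)\,t^n$, where $\#\mathrm{CNCB}(n)$ is the number of bicoloured noncrossing configurations of size $n$. Then $-t-t^2+(1-4t)F-3F^2=0$.
   Context: A bicoloured noncrossing configuration (BNC) of size $n\ge2$ is a regular polygon with $n+1$ vertices labelled $1,\dots,n+1$ clockwise, together with a colouring of every arc $(i,j)$, $1\le i<j\le n+1$, as blue, red or uncoloured, such that no two coloured (blue or red) arcs cross and every red arc is a diagonal. Two arcs $(i,j),(k,l)$ cross if $i<k<j<l$ or $k<i<l<j$. The arcs $(i,i+1)$, $i\in[n]$, are edges, $(1,n+1)$ is the base, and all other arcs are diagonals. By convention there is exactly one BNC of size $1$. -}

module Defs where

open import Data.Bool using (Bool; true; false; _∧_; _∨_; not; if_then_else_)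
open import Data.Nat using (ℕ; zero; suc; _∸_; _<ᵇ_; _≡ᵇ_)
open import Data.Integer using (ℤ) renaming (_+_ to _+ℤ_; _*_ to _*ℤ_; -_ to -ℤ_)
import Data.Integer as ℤ
open import Data.Product using (_×_; _,_)
open import Data.List using (List; []; _∷_; map; concatMap; filter; length; zip; foldr; upTo)

data Colour : Set where
  blue red uncoloured : Colour

isColoured : Colour → Bool
isColoured uncoloured = false
isColoured _          = true

isRed : Colour → Bool
isRed red = true
isRed _   = false

-- An arc (i , j) with 1 ≤ i < j ≤ n+1 (vertices labelled 1 … n+1).
Arc : Set
Arc = ℕ × ℕ

arcs : ℕ → List Arc
arcs n = concatMap (λ i → map (λ j → (suc i , suc j))
                              (filter (λ j → i Data.Nat.<? j) (upTo (suc n))))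
                   (upTo (suc n))

crossᵇ : Arc → Arc → Bool
crossᵇ (i , j) (k , l) =
  ((i <ᵇ k) ∧ (k <ᵇ j) ∧ (j <ᵇ l)) ∨ ((k <ᵇ i) ∧ (i <ᵇ l) ∧ (l <ᵇ j))

-- For size n: (i,i+1) are edges, (1,n+1) is the base, all others diagonals.
isDiagonalᵇ : ℕ → Arc → Bool
isDiagonalᵇ n (i , j) = not (j ≡ᵇ suc i) ∧ not ((i ≡ᵇ 1) ∧ (j ≡ᵇ suc n))

all : {A : Set} → (A → Bool) → List A → Bool
all p = foldr (λ x b → p x ∧ b) true

colourLists : ℕ → List (List Colour)
colourLists zero    = [] ∷ []
colourLists (suc k) =
  concatMap (λ c → map (c ∷_) (colourLists k)) (blue ∷ red ∷ uncoloured ∷ [])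

Config : Set
Config = List (Arc × Colour)

configurations : ℕ → List Config
configurations n = map (zip (arcs n)) (colourLists (length (arcs n)))

isBNCᵇ : ℕ → Config → Bool
isBNCᵇ n cfg =
  all (λ { (a , c) → all (λ { (b , d) →
          not (isColoured c ∧ isColoured d ∧ crossᵇ a b) }) cfg }) cfg
  ∧ all (λ { (a , c) → not (isRed c) ∨ isDiagonalᵇ n a }) cfg

-- #CNCB(n): number of BNCs of size n.  Size 1 is 1 by convention;
-- size 0 is not a size, we set 0 (the constant coefficient of F).
numBNC : ℕ → ℕ
numBNC zero          = 0
numBNC (suc zero)    = 1
numBNC n@(suc (suc _)) = length (filter (λ cfg → Data.Bool._≟_ (isBNCᵇ n cfg) true)
                                        (configurations n))

Series : Set
Series = ℕ → ℤ

const : ℤ → Series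
const a zero    = a
const a (suc _) = ℤ.0ℤ

t : Series
t (suc zero) = ℤ.1ℤ
t _          = ℤ.0ℤ

infixl 6 _⊕_ _⊖_
infixl 7 _⊛_

_⊕_ : Series → Series → Series
(f ⊕ g) n = f n +ℤ g n

⊝_ : Series → Series
(⊝ f) n = -ℤ f n

_⊖_ : Series → Series → Series
f ⊖ g = f ⊕ (⊝ g)

sumTo : ℕ → (ℕ → ℤ) → ℤ
sumTo zero    h = h zero
sumTo (suc n) h = sumTo n h +ℤ h (suc n)

_⊛_ : Series → Series → Series
(f ⊛ g) n = sumTo n (λ i → f i *ℤ g (n ∸ i))

F : Series
F n = ℤ.+ (numBNC n)

-- A BNC of size n is a set of pairwise noncrossing arcs of the (n+1)-gon, each diagonal in it
-- coloured in one of two ways and each edge or the base in one, so #CNCB(n) is a sum over noncrossing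
-- arc sets weighted by 2^(number of diagonals).  Choosing arcs one at a time, a chosen arc blocks
-- every arc crossing it.  Let P m be the weighted count for the polygon on vertices 0, …, m whose
-- base also counts as a diagonal, and O k that for the polygon on 0, …, k+1 without its base.
-- Then F (k+1) = 2 O k for k ≥ 1 (the base is uncoloured or blue) and P (m+1) = 3 O m for m ≥ 1.
-- Sorting by the longest chosen arc (0 , j+1) at vertex 0, which cuts the polygon into an inner
-- polygon counted by O j and an outer one counted by P (M - j), gives
-- O M = P M + Σ_{j<M} F (j+1) P (M - j).  In series form 2 P = 3 F + 2 + t and t O = t P + F P - F,
-- and eliminating P and O leaves F = t + t² + 4 t F + 3 F².

module Submission where

open import Defs
open import Data.Nat using (ℕ)
open import Data.Integer using (+_; 0ℤ; 1ℤ)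
open import Relation.Binary.PropositionalEquality using (_≡_)

import Algebra.Solver.CommutativeMonoid as CommutativeMonoidSolver
import Algebra.Solver.IdempotentCommutativeMonoid as IdempotentCommutativeMonoidSolver
open import Data.Bool using (Bool; true; false; _∧_; _∨_; not; if_then_else_)
import Data.Bool as Bool
open import Data.Bool.Properties
  using (∨-comm; ∨-identityʳ; ∧-zeroʳ; ∧-idempotentCommutativeMonoid; ∨-idempotentCommutativeMonoid)
open import Data.List using (List; []; _∷_; _++_; map; concat; reverse; filter; length; zip; applyUpTo; applyDownFrom)
import Data.List.Properties as List
open import Data.List.Relation.Unary.All as All using (All; []; _∷_)
open import Data.List.Relation.Unary.All.Properties using (++⁺; applyUpTo⁺₁; applyUpTo⁺₂; applyDownFrom⁺₁; applyDownFrom⁺₂)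
open import Data.List.Relation.Binary.Permutation.Propositional
  using (_↭_; prep; swap; ↭-refl; ↭-sym; ↭-reflexive; ↭-trans; module PermutationReasoning)
  renaming (refl to ↭-refl′; trans to ↭-trans′)
import Data.List.Relation.Binary.Permutation.Propositional.Properties as ↭
open import Data.Nat using (zero; suc; _+_; _*_; _∸_; _<ᵇ_; _≡ᵇ_; _≤_; _<_; z≤n; s≤s; s≤s⁻¹; _<?_)
open import Data.Nat.Properties
open import Data.Nat.Tactic.RingSolver using (solve-∀)
open import Data.Product using (_×_; _,_; ∃-syntax)
open import Data.Sum using (_⊎_; inj₁; inj₂)
open import Data.Empty using (⊥-elim)
open import Data.Integer using (ℤ)
import Data.Integer as ℤ
import Data.Integer.Properties as ℤ
import Data.Integer.Tactic.RingSolver as ℤ-Solver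
open import Function using (_∘_)
open import Relation.Binary.PropositionalEquality
  using (_≢_; refl; sym; trans; cong; cong₂; subst; module ≡-Reasoning)

module ∧-Solver = IdempotentCommutativeMonoidSolver ∧-idempotentCommutativeMonoid
module ∨-Solver = IdempotentCommutativeMonoidSolver ∨-idempotentCommutativeMonoid
module ↭-Solver = CommutativeMonoidSolver (↭.++-commutativeMonoid {A = Arc})

⟦_⟧ᵇ : Bool → ℕ
⟦ true  ⟧ᵇ = 1
⟦ false ⟧ᵇ = 0

countᵇ : {A : Set} → (A → Bool) → List A → ℕ
countᵇ p []       = 0
countᵇ p (x ∷ xs) = ⟦ p x ⟧ᵇ + countᵇ p xs

length-filter≡countᵇ : {A : Set} (p : A → Bool) (xs : List A) →
                       length (filter (λ x → p x Bool.≟ true) xs) ≡ countᵇ p xs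
length-filter≡countᵇ p []       = refl
length-filter≡countᵇ p (x ∷ xs) with p x
... | true  = cong suc (length-filter≡countᵇ p xs)
... | false = length-filter≡countᵇ p xs

countᵇ-++ : {A : Set} (p : A → Bool) (xs ys : List A) →
            countᵇ p (xs ++ ys) ≡ countᵇ p xs + countᵇ p ys
countᵇ-++ p []       ys = refl
countᵇ-++ p (x ∷ xs) ys =
  trans (cong₂ _+_ refl (countᵇ-++ p xs ys)) (sym (+-assoc ⟦ p x ⟧ᵇ (countᵇ p xs) (countᵇ p ys)))

countᵇ-map : {A B : Set} (p : B → Bool) (f : A → B) (xs : List A) →
             countᵇ p (map f xs) ≡ countᵇ (p ∘ f) xs
countᵇ-map p f []       = refl
countᵇ-map p f (x ∷ xs) = cong₂ _+_ refl (countᵇ-map p f xs)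

countᵇ-cong : {A : Set} {p q : A → Bool} (xs : List A) → (∀ x → p x ≡ q x) →
              countᵇ p xs ≡ countᵇ q xs
countᵇ-cong []       p≗q = refl
countᵇ-cong (x ∷ xs) p≗q = cong₂ _+_ (cong ⟦_⟧ᵇ (p≗q x)) (countᵇ-cong xs p≗q)

countᵇ-guard : {A : Set} (b : Bool) (p : A → Bool) (xs : List A) →
               countᵇ (λ x → b ∧ p x) xs ≡ (if b then countᵇ p xs else 0)
countᵇ-guard true  p xs       = refl
countᵇ-guard false p []       = refl
countᵇ-guard false p (x ∷ xs) = countᵇ-guard false p xs

countᵇ-colourLists : ∀ k (p : List Colour → Bool) →
  countᵇ p (colourLists (suc k)) ≡
  countᵇ (p ∘ (blue ∷_)) (colourLists k)
    + (countᵇ (p ∘ (red ∷_)) (colourLists k) + countᵇ (p ∘ (uncoloured ∷_)) (colourLists k))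
countᵇ-colourLists k p = begin
  countᵇ p (blue⋯ ++ red⋯ ++ uncoloured⋯ ++ [])
    ≡⟨ countᵇ-++ p blue⋯ _ ⟩
  countᵇ p blue⋯ + countᵇ p (red⋯ ++ uncoloured⋯ ++ [])
    ≡⟨ cong₂ _+_ refl (countᵇ-++ p red⋯ _) ⟩
  countᵇ p blue⋯ + (countᵇ p red⋯ + countᵇ p (uncoloured⋯ ++ []))
    ≡⟨ cong (λ us → countᵇ p blue⋯ + (countᵇ p red⋯ + countᵇ p us)) (List.++-identityʳ uncoloured⋯) ⟩
  countᵇ p blue⋯ + (countᵇ p red⋯ + countᵇ p uncoloured⋯)
    ≡⟨ cong₂ _+_ (countᵇ-map p _ (colourLists k))
             (cong₂ _+_ (countᵇ-map p _ (colourLists k)) (countᵇ-map p _ (colourLists k))) ⟩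
  _ ∎
  where
  open ≡-Reasoning
  blue⋯       = map (blue ∷_) (colourLists k)
  red⋯        = map (red ∷_) (colourLists k)
  uncoloured⋯ = map (uncoloured ∷_) (colourLists k)

all-cong : {A : Set} {p q : A → Bool} (xs : List A) → (∀ x → p x ≡ q x) → all p xs ≡ all q xs
all-cong []       p≗q = refl
all-cong (x ∷ xs) p≗q = cong₂ _∧_ (p≗q x) (all-cong xs p≗q)

all-∧ : {A : Set} (p q : A → Bool) (xs : List A) → all (λ x → p x ∧ q x) xs ≡ all p xs ∧ all q xs
all-∧ p q []       = refl
all-∧ p q (x ∷ xs) rewrite all-∧ p q xs = ∧-interchange (p x) (q x) (all p xs) (all q xs)
  where
  open ∧-Solver using (solve; _⊜_) renaming (_⊕_ to _·_)
  ∧-interchange : ∀ a b c d → (a ∧ b) ∧ (c ∧ d) ≡ (a ∧ c) ∧ (b ∧ d)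
  ∧-interchange = solve 4 (λ a b c d → (a · b) · (c · d) ⊜ (a · c) · (b · d)) refl

all-true : {A : Set} (p : A → Bool) (xs : List A) → (∀ x → p x ≡ true) → all p xs ≡ true
all-true p []       p≡true = refl
all-true p (x ∷ xs) p≡true rewrite p≡true x = all-true p xs p≡true

<ᵇ-irrefl : ∀ i → (i <ᵇ i) ≡ false
<ᵇ-irrefl zero    = refl
<ᵇ-irrefl (suc i) = <ᵇ-irrefl i

crossᵇ-irrefl : ∀ a → crossᵇ a a ≡ false
crossᵇ-irrefl (i , j) rewrite <ᵇ-irrefl i = refl

crossᵇ-sym : ∀ a b → crossᵇ a b ≡ crossᵇ b a
crossᵇ-sym (i , j) (k , l) = ∨-comm ((i <ᵇ k) ∧ (k <ᵇ j) ∧ (j <ᵇ l)) _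

<⇒<ᵇ≡true : ∀ {m n} → m < n → (m <ᵇ n) ≡ true
<⇒<ᵇ≡true {zero}  {suc n} _         = refl
<⇒<ᵇ≡true {suc m} {suc n} (s≤s m<n) = <⇒<ᵇ≡true m<n

≥⇒<ᵇ≡false : ∀ {m n} → n ≤ m → (m <ᵇ n) ≡ false
≥⇒<ᵇ≡false {m}     {zero}  _         = refl
≥⇒<ᵇ≡false {suc m} {suc n} (s≤s n≤m) = ≥⇒<ᵇ≡false n≤m

crossᵇ≡false : ∀ p q i j → p ≤ i → j ≤ q ⊎ q ≤ i → crossᵇ (p , q) (i , j) ≡ false
crossᵇ≡false p q i j p≤i (inj₁ j≤q) rewrite ≥⇒<ᵇ≡false p≤i | ≥⇒<ᵇ≡false j≤q =
  trans (∨-identityʳ _) (trans (cong ((p <ᵇ i) ∧_) (∧-zeroʳ (i <ᵇ q))) (∧-zeroʳ (p <ᵇ i)))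
crossᵇ≡false p q i j p≤i (inj₂ q≤i) rewrite ≥⇒<ᵇ≡false p≤i | ≥⇒<ᵇ≡false q≤i =
  trans (∨-identityʳ _) (∧-zeroʳ (p <ᵇ i))

crossᵇ≡true : ∀ p q i j → p < i → i < q → q < j → crossᵇ (p , q) (i , j) ≡ true
crossᵇ≡true p q i j p<i i<q q<j rewrite <⇒<ᵇ≡true p<i | <⇒<ᵇ≡true i<q | <⇒<ᵇ≡true q<j = refl

≡ᵇ-refl : ∀ n → (n ≡ᵇ n) ≡ true
≡ᵇ-refl zero    = refl
≡ᵇ-refl (suc n) = ≡ᵇ-refl n

≢⇒≡ᵇ≡false : ∀ {m n} → m ≢ n → (m ≡ᵇ n) ≡ false
≢⇒≡ᵇ≡false {zero}  {zero}  0≢0 = ⊥-elim (0≢0 refl)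
≢⇒≡ᵇ≡false {zero}  {suc n} _   = refl
≢⇒≡ᵇ≡false {suc m} {zero}  _   = refl
≢⇒≡ᵇ≡false {suc m} {suc n} m≢n = ≢⇒≡ᵇ≡false (m≢n ∘ cong suc)

-- Weighted sums over noncrossing sets of arcs

Blocked : Set
Blocked = Arc → Bool

∅ : Blocked
∅ _ = false

block : Arc → Blocked → Blocked
block a B x = B x ∨ crossᵇ a x

-- The sum, over the pairwise noncrossing subsets S of L containing no blocked arc,
-- of the weight ∏_{a ∈ S} w a.
ncSum : (Arc → ℕ) → List Arc → Blocked → ℕ
ncSum w []      B = 1
ncSum w (a ∷ L) B = ncSum w L B + (if B a then 0 else w a * ncSum w L (block a B))

ncSum-congᴮ : ∀ w L {B B′} → All (λ x → B x ≡ B′ x) L → ncSum w L B ≡ ncSum w L B′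
ncSum-congᴮ w []      []             = refl
ncSum-congᴮ w (a ∷ L) {B′ = B′} (Ba≡ ∷ B≗) rewrite Ba≡ =
  cong₂ _+_ (ncSum-congᴮ w L B≗)
            (cong (λ n → if B′ a then 0 else w a * n)
                  (ncSum-congᴮ w L (All.map (λ {x} Bx≡ → cong (_∨ crossᵇ a x) Bx≡) B≗)))

ncSum-congʷ : ∀ {w w′} L {B} → All (λ x → w x ≡ w′ x) L → ncSum w L B ≡ ncSum w′ L B
ncSum-congʷ []      []             = refl
ncSum-congʷ {w′ = w′} (a ∷ L) {B} (wa≡ ∷ w≗) rewrite wa≡ =
  cong₂ _+_ (ncSum-congʷ L w≗) (cong (λ n → if B a then 0 else w′ a * n) (ncSum-congʷ L w≗))

block-comm : ∀ x y B z → block y (block x B) z ≡ block x (block y B) z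
block-comm x y B z = ∨-swap (B z) (crossᵇ x z) (crossᵇ y z)
  where
  open ∨-Solver using (solve; _⊜_) renaming (_⊕_ to _·_)
  ∨-swap : ∀ a b c → (a ∨ b) ∨ c ≡ (a ∨ c) ∨ b
  ∨-swap = solve 3 (λ a b c → (a · b) · c ⊜ (a · c) · b) refl

ncSum-swap : ∀ w x y L B → ncSum w (x ∷ y ∷ L) B ≡ ncSum w (y ∷ x ∷ L) B
ncSum-swap w x y L B
  rewrite crossᵇ-sym y x
        | ncSum-congᴮ w L (All.tabulate {xs = L} λ {z} _ → block-comm x y B z)
  with B x | B y | crossᵇ x y
... | true  | true  | _     = refl
... | true  | false | _     = ar (ncSum w L B) (w y) (ncSum w L (block y B))
  where ar : ∀ a v b → a + v * b + 0 ≡ a + 0 + v * (b + 0)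
        ar = solve-∀
... | false | true  | _     = ar (ncSum w L B) (w x) (ncSum w L (block x B))
  where ar : ∀ a u c → a + 0 + u * (c + 0) ≡ a + u * c + 0
        ar = solve-∀
... | false | false | true  = ar (ncSum w L B) (w x) (w y) (ncSum w L (block x B)) (ncSum w L (block y B))
  where ar : ∀ a u v c b → a + v * b + u * (c + 0) ≡ a + u * c + v * (b + 0)
        ar = solve-∀
... | false | false | false =
  ar (ncSum w L B) (w x) (w y) (ncSum w L (block x B)) (ncSum w L (block y B))
     (ncSum w L (block x (block y B)))
  where ar : ∀ a u v c b d → a + v * b + u * (c + v * d) ≡ a + u * c + v * (b + u * d)
        ar = solve-∀

ncSum-cons : ∀ w a {L L′} → (∀ B → ncSum w L B ≡ ncSum w L′ B) →
             ∀ B → ncSum w (a ∷ L) B ≡ ncSum w (a ∷ L′) B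
ncSum-cons w a L≈L′ B = cong₂ _+_ (L≈L′ B) (cong (λ n → if B a then 0 else w a * n) (L≈L′ _))

ncSum-↭ : ∀ w {L L′} → L ↭ L′ → ∀ B → ncSum w L B ≡ ncSum w L′ B
ncSum-↭ w ↭-refl′                  B = refl
ncSum-↭ w (prep {xs} {ys} a L↭L′)  B = ncSum-cons w a {xs} {ys} (ncSum-↭ w L↭L′) B
ncSum-↭ w (swap {xs} {ys} x y L↭L′) B =
  trans (ncSum-swap w x y xs B)
        (ncSum-cons w y {x ∷ xs} {x ∷ ys} (ncSum-cons w x {xs} {ys} (ncSum-↭ w L↭L′)) B)
ncSum-↭ w (↭-trans′ L↭L′ L′↭L″)    B = trans (ncSum-↭ w L↭L′ B) (ncSum-↭ w L′↭L″ B)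

ncSum-++-blocked : ∀ w M L B → All (λ x → B x ≡ true) M → ncSum w (M ++ L) B ≡ ncSum w L B
ncSum-++-blocked w []      L B []             = refl
ncSum-++-blocked w (a ∷ M) L B (Ba≡true ∷ M⊆B) rewrite Ba≡true =
  trans (+-identityʳ _) (ncSum-++-blocked w M L B M⊆B)

ncSum-++ : ∀ w L₁ L₂ B → All (λ x → All (λ y → crossᵇ x y ≡ false) L₂) L₁ →
           ncSum w (L₁ ++ L₂) B ≡ ncSum w L₁ B * ncSum w L₂ B
ncSum-++ w []       L₂ B []                 = sym (+-identityʳ _)
ncSum-++ w (a ∷ L₁) L₂ B (a∦L₂ ∷ L₁∦L₂) with B a
... | true  = trans (+-identityʳ _)
                    (trans (ncSum-++ w L₁ L₂ B L₁∦L₂) (cong (_* ncSum w L₂ B) (sym (+-identityʳ (ncSum w L₁ B)))))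
... | false = begin
  ncSum w (L₁ ++ L₂) B + w a * ncSum w (L₁ ++ L₂) (block a B)
    ≡⟨ cong₂ (λ m n → m + w a * n) (ncSum-++ w L₁ L₂ B L₁∦L₂) (ncSum-++ w L₁ L₂ (block a B) L₁∦L₂) ⟩
  ncSum w L₁ B * ncSum w L₂ B + w a * (ncSum w L₁ (block a B) * ncSum w L₂ (block a B))
    ≡⟨ cong (λ n → ncSum w L₁ B * ncSum w L₂ B + w a * (ncSum w L₁ (block a B) * n))
            (ncSum-congᴮ w L₂ (All.map (λ {y} a∦y → trans (cong (B y ∨_) a∦y) (∨-identityʳ (B y))) a∦L₂)) ⟩
  ncSum w L₁ B * ncSum w L₂ B + w a * (ncSum w L₁ (block a B) * ncSum w L₂ B)
    ≡⟨ ar (ncSum w L₁ B) (ncSum w L₂ B) (w a) (ncSum w L₁ (block a B)) ⟩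
  (ncSum w L₁ B + w a * ncSum w L₁ (block a B)) * ncSum w L₂ B ∎
  where
  open ≡-Reasoning
  ar : ∀ p q r s → p * q + r * (s * q) ≡ (p + r * s) * q
  ar = solve-∀

shift : Arc → Arc
shift (i , j) = (suc i , suc j)

ncSum-shift : ∀ w L B → ncSum w (map shift L) B ≡ ncSum (w ∘ shift) L (B ∘ shift)
ncSum-shift w []            B = refl
ncSum-shift w ((i , j) ∷ L) B = cong₂ _+_ (ncSum-shift w L B)
  (cong (λ n → if B (suc i , suc j) then 0 else w (suc i , suc j) * n)
        (trans (ncSum-shift w L _) (ncSum-congᴮ _ L (All.tabulate λ { {k , l} _ → refl }))))

ncSum-∷-uncrossed : ∀ w a L → All (λ x → crossᵇ a x ≡ false) L → ncSum w (a ∷ L) ∅ ≡ (1 + w a) * ncSum w L ∅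
ncSum-∷-uncrossed w a L a∦L = cong (λ n → ncSum w L ∅ + w a * n) (ncSum-congᴮ w L a∦L)

-- Bicoloured configurations as a weighted noncrossing sum

compatible : Arc × Colour → Arc × Colour → Bool
compatible (a , c) (b , d) = not (isColoured c ∧ isColoured d ∧ crossᵇ a b)

pairwiseCompatible : Config → Bool
pairwiseCompatible cfg = all (λ x → all (compatible x) cfg) cfg

redOnDiagonal : ℕ → Arc × Colour → Bool
redOnDiagonal n (a , c) = not (isRed c) ∨ isDiagonalᵇ n a

avoids : Blocked → Arc × Colour → Bool
avoids B (b , d) = not (isColoured d ∧ B b)

isBNCᵇ-unfold : ∀ n cfg → isBNCᵇ n cfg ≡ pairwiseCompatible cfg ∧ all (redOnDiagonal n) cfg
isBNCᵇ-unfold n cfg = cong₂ _∧_ (all-cong cfg λ { (a , c) → all-cong cfg λ { (b , d) → refl } })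
                          (all-cong cfg λ { (a , c) → refl })

compatible-self : ∀ x → compatible x x ≡ true
compatible-self (a , c) rewrite crossᵇ-irrefl a with isColoured c
... | true  = refl
... | false = refl

compatible-sym : ∀ x y → compatible x y ≡ compatible y x
compatible-sym (a , c) (b , d) rewrite crossᵇ-sym a b with isColoured c | isColoured d
... | true  | true  = refl
... | true  | false = refl
... | false | true  = refl
... | false | false = refl

pairwiseCompatible-∷ : ∀ x cfg → pairwiseCompatible (x ∷ cfg) ≡
                       all (compatible x) cfg ∧ (all (compatible x) cfg ∧ pairwiseCompatible cfg)
pairwiseCompatible-∷ x cfg
  rewrite compatible-self x
        | all-∧ (λ y → compatible y x) (λ y → all (compatible y) cfg) cfg
        | all-cong cfg (λ y → compatible-sym y x) = refl

avoids-block : ∀ B a c cfg → isColoured c ≡ true →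
               all (avoids (block a B)) cfg ≡ all (avoids B) cfg ∧ all (compatible (a , c)) cfg
avoids-block B a c cfg c-coloured =
  trans (all-cong cfg λ { (b , d) → split c-coloured (isColoured d) (B b) (crossᵇ a b) })
        (all-∧ (avoids B) (compatible (a , c)) cfg)
  where
  split : ∀ {k} → k ≡ true → ∀ d p q → not (d ∧ (p ∨ q)) ≡ not (d ∧ p) ∧ not (k ∧ d ∧ q)
  split refl false p     q = refl
  split refl true  true  q = refl
  split refl true  false q = refl

valid : ℕ → Config → Blocked → Bool
valid n []              B = true
valid n ((a , c) ∷ cfg) B =
  if isColoured c then (not (B a) ∧ redOnDiagonal n (a , c)) ∧ valid n cfg (block a B)
                  else valid n cfg B

∧-shuffle : ∀ p r q A C G → (p ∧ r) ∧ ((q ∧ A) ∧ (C ∧ G)) ≡ (p ∧ q) ∧ ((A ∧ (A ∧ C)) ∧ (r ∧ G))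
∧-shuffle = solve 6 (λ p r q A C G → (p · r) · ((q · A) · (C · G)) ⊜ (p · q) · ((A · (A · C)) · (r · G))) refl
  where open ∧-Solver using (solve; _⊜_) renaming (_⊕_ to _·_)

valid≡ : ∀ n cfg B →
         valid n cfg B ≡ all (avoids B) cfg ∧ (pairwiseCompatible cfg ∧ all (redOnDiagonal n) cfg)
valid≡ n [] B = refl
valid≡ n ((a , uncoloured) ∷ cfg) B
  rewrite pairwiseCompatible-∷ (a , uncoloured) cfg
        | all-true (compatible (a , uncoloured)) cfg (λ { (b , d) → refl }) = valid≡ n cfg B
valid≡ n ((a , blue) ∷ cfg) B
  rewrite pairwiseCompatible-∷ (a , blue) cfg | valid≡ n cfg (block a B) | avoids-block B a blue cfg refl =
  ∧-shuffle (not (B a)) true (all (avoids B) cfg) (all (compatible (a , blue)) cfg)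
          (pairwiseCompatible cfg) (all (redOnDiagonal n) cfg)
valid≡ n ((a , red) ∷ cfg) B
  rewrite pairwiseCompatible-∷ (a , red) cfg | valid≡ n cfg (block a B) | avoids-block B a red cfg refl =
  ∧-shuffle (not (B a)) (isDiagonalᵇ n a) (all (avoids B) cfg) (all (compatible (a , red)) cfg)
          (pairwiseCompatible cfg) (all (redOnDiagonal n) cfg)

isBNCᵇ≡valid : ∀ n cfg → isBNCᵇ n cfg ≡ valid n cfg ∅
isBNCᵇ≡valid n cfg rewrite valid≡ n cfg ∅
                         | all-true (avoids ∅) cfg (λ { (b , d) → cong not (∧-zeroʳ (isColoured d)) }) =
  isBNCᵇ-unfold n cfg

-- Blue or red on a diagonal, blue only on an edge or the base.
colourWeight : ℕ → Arc → ℕ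
colourWeight n a = if isDiagonalᵇ n a then 2 else 1

countᵇ-valid≡ncSum : ∀ n L B →
  countᵇ (λ cs → valid n (zip L cs) B) (colourLists (length L)) ≡ ncSum (colourWeight n) L B
countᵇ-valid≡ncSum n []      B = refl
countᵇ-valid≡ncSum n (a ∷ L) B = begin
  countᵇ (λ cs → valid n (zip (a ∷ L) cs) B) (colourLists (suc (length L)))
    ≡⟨ countᵇ-colourLists (length L) _ ⟩
  countᵇ (λ cs → (not (B a) ∧ true) ∧ valid n (zip L cs) (block a B)) Cs
    + (countᵇ (λ cs → (not (B a) ∧ isDiagonalᵇ n a) ∧ valid n (zip L cs) (block a B)) Cs
       + countᵇ (λ cs → valid n (zip L cs) B) Cs)
    ≡⟨ cong₂ _+_ (countᵇ-guard (not (B a) ∧ true) _ Cs)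
                 (cong₂ _+_ (countᵇ-guard (not (B a) ∧ isDiagonalᵇ n a) _ Cs) refl) ⟩
  (if not (B a) ∧ true then countᵇ (λ cs → valid n (zip L cs) (block a B)) Cs else 0)
    + ((if not (B a) ∧ isDiagonalᵇ n a then countᵇ (λ cs → valid n (zip L cs) (block a B)) Cs else 0)
       + countᵇ (λ cs → valid n (zip L cs) B) Cs)
    ≡⟨ cong₂ (λ y x → (if not (B a) ∧ true then y else 0)
                         + ((if not (B a) ∧ isDiagonalᵇ n a then y else 0) + x))
             (countᵇ-valid≡ncSum n L (block a B)) (countᵇ-valid≡ncSum n L B) ⟩
  (if not (B a) ∧ true then ncSum w L (block a B) else 0)
    + ((if not (B a) ∧ isDiagonalᵇ n a then ncSum w L (block a B) else 0) + ncSum w L B)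
    ≡⟨ colourChoices (B a) (isDiagonalᵇ n a) (ncSum w L B) (ncSum w L (block a B)) ⟩
  ncSum w (a ∷ L) B ∎
  where
  open ≡-Reasoning
  w  = colourWeight n
  Cs = colourLists (length L)
  colourChoices : ∀ b d x y →
    (if not b ∧ true then y else 0) + ((if not b ∧ d then y else 0) + x) ≡
    x + (if b then 0 else (if d then 2 else 1) * y)
  colourChoices true  d     x y = sym (+-identityʳ x)
  colourChoices false true  x y = ar x y
    where ar : ∀ x y → y + (y + x) ≡ x + 2 * y
          ar = solve-∀
  colourChoices false false x y = ar x y
    where ar : ∀ x y → y + (0 + x) ≡ x + 1 * y
          ar = solve-∀

numBNC≡ncSum : ∀ m → let n = suc (suc m) in numBNC n ≡ ncSum (colourWeight n) (arcs n) ∅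
numBNC≡ncSum m = begin
  length (filter (λ cfg → isBNCᵇ n cfg Bool.≟ true) (map (zip (arcs n)) Cs))
    ≡⟨ length-filter≡countᵇ (isBNCᵇ n) (map (zip (arcs n)) Cs) ⟩
  countᵇ (isBNCᵇ n) (map (zip (arcs n)) Cs)
    ≡⟨ countᵇ-map (isBNCᵇ n) (zip (arcs n)) Cs ⟩
  countᵇ (λ cs → isBNCᵇ n (zip (arcs n) cs)) Cs
    ≡⟨ countᵇ-cong Cs (λ cs → isBNCᵇ≡valid n (zip (arcs n) cs)) ⟩
  countᵇ (λ cs → valid n (zip (arcs n) cs) ∅) Cs
    ≡⟨ countᵇ-valid≡ncSum n (arcs n) ∅ ⟩
  ncSum (colourWeight n) (arcs n) ∅ ∎
  where
  open ≡-Reasoning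
  n  = suc (suc m)
  Cs = colourLists (length (arcs n))

Within : ℕ → ℕ → Arc → Set
Within lo hi (i , j) = lo ≤ i × i < j × j ≤ hi

Straddles : ℕ → ℕ → Arc → Set
Straddles lo mid (i , j) = lo ≤ i × i < mid × mid < j

Within-mono : ∀ {lo lo′ hi hi′} → lo′ ≤ lo → hi ≤ hi′ → ∀ {x} → Within lo hi x → Within lo′ hi′ x
Within-mono lo′≤lo hi≤hi′ (lo≤i , i<j , j≤hi) = ≤-trans lo′≤lo lo≤i , i<j , ≤-trans j≤hi hi≤hi′

applyDownFrom-+ : ∀ {A : Set} (f : ℕ → A) p q →
                  applyDownFrom f (p + q) ≡ applyDownFrom (λ m → f (m + q)) p ++ applyDownFrom f q
applyDownFrom-+ f zero    q = refl
applyDownFrom-+ f (suc p) q = cong (f (p + q) ∷_) (applyDownFrom-+ f p q)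

fan : ℕ → ℕ → List Arc
fan a = applyDownFrom (λ m → (a , suc a + m))

polygonArcs : ℕ → ℕ → List Arc
polygonArcs a zero    = []
polygonArcs a (suc M) = fan a (suc M) ++ polygonArcs (suc a) M

fan-within : ∀ a k → All (Within a (a + k)) (fan a k)
fan-within a k = applyDownFrom⁺₁ _ k λ {m} m<k →
  ≤-refl , s≤s (m≤m+n a m) , ≤-trans (≤-reflexive (sym (+-suc a m))) (+-monoʳ-≤ a m<k)

polygonArcs-within : ∀ a M → All (Within a (a + M)) (polygonArcs a M)
polygonArcs-within a zero    = []
polygonArcs-within a (suc M) =
  ++⁺ (fan-within a (suc M))
      (All.map (Within-mono (n≤1+n a) (≤-reflexive (sym (+-suc a M)))) (polygonArcs-within (suc a) M))

polygonArcs-split : ∀ a k r → ∃[ S ] (polygonArcs a (k + r) ↭ (polygonArcs a k ++ polygonArcs (a + k) r) ++ S)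
                                     × All (Straddles a (a + k)) S
polygonArcs-split a zero    r rewrite +-identityʳ a = [] , ↭-sym (↭-reflexive (List.++-identityʳ _)) , []
polygonArcs-split a (suc k) r with polygonArcs-split (suc a) k r
... | S , split , S-straddles = top ++ S , perm , ++⁺ top-straddles (All.map widen S-straddles)
  where
  top = applyDownFrom (λ m → (a , suc a + (m + suc k))) r
  top-straddles : All (Straddles a (a + suc k)) top
  top-straddles = applyDownFrom⁺₂ _ r λ m →
    ≤-refl , m<m+n a (s≤s z≤n) , s≤s (+-monoʳ-≤ a (m≤n+m (suc k) m))
  widen : ∀ {x} → Straddles (suc a) (suc a + k) x → Straddles a (a + suc k) x
  widen {x} (a<i , i<m , m<j) rewrite +-suc a k = ≤-trans (n≤1+n a) a<i , i<m , m<j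
  fan-split : fan a (suc k + r) ≡ top ++ fan a (suc k)
  fan-split = trans (cong (fan a) (+-comm (suc k) r)) (applyDownFrom-+ _ r (suc k))
  perm : polygonArcs a (suc k + r) ↭ (polygonArcs a (suc k) ++ polygonArcs (a + suc k) r) ++ (top ++ S)
  perm = ↭-trans (↭.++⁺ (↭-reflexive fan-split) split)
         (↭-trans (regroup top (fan a (suc k)) (polygonArcs (suc a) k) (polygonArcs (suc a + k) r) S)
                  (↭-reflexive (cong (λ b → (polygonArcs a (suc k) ++ polygonArcs b r) ++ (top ++ S))
                                     (sym (+-suc a k)))))
    where
    open ↭-Solver using (solve; _⊜_) renaming (_⊕_ to _·_)
    regroup : ∀ T F A B S → (T ++ F) ++ ((A ++ B) ++ S) ↭ ((F ++ A) ++ B) ++ (T ++ S)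
    regroup = solve 5 (λ T F A B S → (T · F) · ((A · B) · S) ⊜ ((F · A) · B) · (T · S)) ↭-refl

fanPolygonArcs : ℕ → ℕ → ℕ → List Arc
fanPolygonArcs a k M = fan a k ++ polygonArcs (suc a) M

fanPolygonArcs-within : ∀ a k → All (Within a (suc a + k)) (fanPolygonArcs a k k)
fanPolygonArcs-within a k =
  ++⁺ (All.map (Within-mono ≤-refl (n≤1+n (a + k))) (fan-within a k))
      (All.map (Within-mono (n≤1+n a) ≤-refl) (polygonArcs-within (suc a) k))

ncSum-fanPolygonArcs-split : ∀ w a k r →
  ncSum w (fanPolygonArcs a k (k + r)) (block (a , suc a + k) ∅) ≡
  ncSum w (fanPolygonArcs a k k) ∅ * ncSum w (polygonArcs (suc a + k) r) ∅
ncSum-fanPolygonArcs-split w a k r with polygonArcs-split (suc a) k r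
... | S , split , S-straddles = begin
  ncSum w (fan a k ++ polygonArcs (suc a) (k + r)) Bq
    ≡⟨ ncSum-↭ w (↭-trans (↭.++⁺ˡ (fan a k) split) (regroup (fan a k) _ Outer S)) Bq ⟩
  ncSum w (S ++ (Inner ++ Outer)) Bq
    ≡⟨ ncSum-++-blocked w S _ Bq (All.map (λ { {i , j} (a<i , i<q , q<j) → crossᵇ≡true a q i j a<i i<q q<j })
                                           S-straddles) ⟩
  ncSum w (Inner ++ Outer) Bq
    ≡⟨ ncSum-congᴮ w (Inner ++ Outer) (++⁺ (All.map inner-uncrossed Inner-within)
                                           (All.map outer-uncrossed Outer-within)) ⟩
  ncSum w (Inner ++ Outer) ∅
    ≡⟨ ncSum-++ w Inner Outer ∅ (All.map (λ x∈Inner → All.map (inner∦outer x∈Inner) Outer-within) Inner-within) ⟩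
  ncSum w Inner ∅ * ncSum w Outer ∅ ∎
  where
  open ≡-Reasoning
  q     = suc a + k
  Bq    = block (a , q) ∅
  Inner = fanPolygonArcs a k k
  Outer = polygonArcs q r
  Inner-within = fanPolygonArcs-within a k
  Outer-within = polygonArcs-within q r
  inner-uncrossed : ∀ {x} → Within a q x → crossᵇ (a , q) x ≡ false
  inner-uncrossed {i , j} (a≤i , _ , j≤q) = crossᵇ≡false a q i j a≤i (inj₁ j≤q)
  outer-uncrossed : ∀ {x} → Within q (q + r) x → crossᵇ (a , q) x ≡ false
  outer-uncrossed {i , j} (q≤i , _ , _) = crossᵇ≡false a q i j (≤-trans (≤-trans (n≤1+n a) (m≤m+n (suc a) k)) q≤i) (inj₂ q≤i)
  inner∦outer : ∀ {x y} → Within a q x → Within q (q + r) y → crossᵇ x y ≡ false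
  inner∦outer {i , j} {k , l} (_ , i<j , j≤q) (q≤k , _ , _) =
    crossᵇ≡false i j k l (≤-trans (<⇒≤ i<j) (≤-trans j≤q q≤k)) (inj₂ (≤-trans j≤q q≤k))
  open ↭-Solver using (solve; _⊜_) renaming (_⊕_ to _·_)
  regroup : ∀ X A B S → X ++ ((A ++ B) ++ S) ↭ S ++ ((X ++ A) ++ B)
  regroup = solve 4 (λ X A B S → X · ((A · B) · S) ⊜ S · ((X · A) · B)) ↭-refl

fan-shift : ∀ a k → fan (suc a) k ≡ map shift (fan a k)
fan-shift a k = sym (List.map-applyDownFrom _ shift k)

polygonArcs-shift : ∀ M a → polygonArcs (suc a) M ≡ map shift (polygonArcs a M)
polygonArcs-shift zero    a = refl
polygonArcs-shift (suc M) a =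
  trans (cong₂ _++_ (fan-shift a (suc M)) (polygonArcs-shift M (suc a)))
        (sym (List.map-++ shift (fan a (suc M)) (polygonArcs (suc a) M)))

fanPolygonArcs-shift : ∀ k M a → fanPolygonArcs (suc a) k M ≡ map shift (fanPolygonArcs a k M)
fanPolygonArcs-shift k M a =
  trans (cong₂ _++_ (fan-shift a k) (polygonArcs-shift M (suc a)))
        (sym (List.map-++ shift (fan a k) (polygonArcs (suc a) M)))

applyUpTo-+ : ∀ {A : Set} (f : ℕ → A) p q →
              applyUpTo f (p + q) ≡ applyUpTo f p ++ applyUpTo (λ m → f (p + m)) q
applyUpTo-+ f zero    q = refl
applyUpTo-+ f (suc p) q = cong (f 0 ∷_) (applyUpTo-+ (f ∘ suc) p q)

-- The arcs of Defs.arcs starting at vertex i+1.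
row : ℕ → ℕ → List Arc
row n i = map (λ j → (suc i , suc j)) (filter (λ j → i <? j) (applyUpTo (λ j → j) (suc n)))

row-↭-fan : ∀ {n j} i r → n ≡ i + r → j ≡ i → row n j ↭ fan (suc i) r
row-↭-fan i r refl refl = begin
  map (λ j → (suc i , suc j)) (filter (i <?_) (applyUpTo (λ j → j) (suc i + r)))
    ≡⟨ cong (map (λ j → (suc i , suc j)))
            (trans (cong (filter (i <?_)) (applyUpTo-+ (λ j → j) (suc i) r)) larger) ⟩
  map (λ j → (suc i , suc j)) (applyUpTo (λ m → suc i + m) r)
    ≡⟨ List.map-applyUpTo (λ m → suc i + m) (λ j → (suc i , suc j)) r ⟩
  applyUpTo (λ m → (suc i , suc (suc i + m))) r
    ↭⟨ ↭-sym (↭.↭-reverse (applyUpTo (λ m → (suc i , suc (suc i + m))) r)) ⟩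
  reverse (applyUpTo (λ m → (suc i , suc (suc i + m))) r)
    ≡⟨ List.reverse-applyUpTo (λ m → (suc i , suc (suc i + m))) r ⟩
  fan (suc i) r ∎
  where
  open PermutationReasoning
  larger : filter (i <?_) (applyUpTo (λ j → j) (suc i) ++ applyUpTo (λ m → suc i + m) r) ≡
           applyUpTo (λ m → suc i + m) r
  larger = trans (List.filter-++ (i <?_) (applyUpTo (λ j → j) (suc i)) _)
                 (cong₂ _++_ (List.filter-none (i <?_) (applyUpTo⁺₁ _ (suc i) λ j<1+i → ≤⇒≯ (s≤s⁻¹ j<1+i)))
                             (List.filter-all (i <?_) (applyUpTo⁺₂ _ r λ m → s≤s (m≤m+n i m))))

rows-↭-polygonArcs : ∀ {n} k r (f : ℕ → ℕ) → n ≡ k + r → (∀ m → f m ≡ k + m) →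
                     concat (map (row n) (applyUpTo f (suc r))) ↭ polygonArcs (suc k) r
rows-↭-polygonArcs k zero    f n≡k+r f≗k+ =
  ↭.++⁺ (row-↭-fan k zero n≡k+r (trans (f≗k+ 0) (+-identityʳ k))) ↭-refl
rows-↭-polygonArcs k (suc r) f n≡k+r f≗k+ =
  ↭.++⁺ (row-↭-fan k (suc r) n≡k+r (trans (f≗k+ 0) (+-identityʳ k)))
        (rows-↭-polygonArcs (suc k) r (f ∘ suc) (trans n≡k+r (+-suc k r)) (λ m → trans (f≗k+ (suc m)) (+-suc k m)))

arcs-↭-polygonArcs : ∀ n → arcs n ↭ polygonArcs 1 n
arcs-↭-polygonArcs n = rows-↭-polygonArcs 0 n (λ j → j) refl (λ _ → refl)

-- Polygon counts and their recurrences

-- Inside the polygon every arc except the edges (i , i+1) can be blue or red.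
ω : Arc → ℕ
ω (i , j) = if j ≡ᵇ suc i then 1 else 2

ncSum-ω-translate : (arcsAt : ℕ → List Arc) → (∀ a → arcsAt (suc a) ≡ map shift (arcsAt a)) →
                    ∀ a → ncSum ω (arcsAt a) ∅ ≡ ncSum ω (arcsAt 0) ∅
ncSum-ω-translate arcsAt shifted zero    = refl
ncSum-ω-translate arcsAt shifted (suc a) = begin
  ncSum ω (arcsAt (suc a)) ∅         ≡⟨ cong (λ L → ncSum ω L ∅) (shifted a) ⟩
  ncSum ω (map shift (arcsAt a)) ∅   ≡⟨ ncSum-shift ω (arcsAt a) ∅ ⟩
  ncSum (ω ∘ shift) (arcsAt a) ∅     ≡⟨ ncSum-congʷ (arcsAt a) (All.tabulate λ { {i , j} _ → refl }) ⟩
  ncSum ω (arcsAt a) ∅               ≡⟨ ncSum-ω-translate arcsAt shifted a ⟩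
  ncSum ω (arcsAt 0) ∅               ∎
  where open ≡-Reasoning

-- The polygon on 0, …, M, its base (0 , M) weighted like a diagonal.
polygonCount : ℕ → ℕ
polygonCount M = ncSum ω (polygonArcs 0 M) ∅

fanPolygonCount : ℕ → ℕ → ℕ
fanPolygonCount k M = ncSum ω (fanPolygonArcs 0 k M) ∅

-- The polygon on 0, …, k+1 with its base (0 , k+1) removed.
openPolygonCount : ℕ → ℕ
openPolygonCount k = fanPolygonCount k k

fanPolygonCount-zero : ∀ M → fanPolygonCount 0 M ≡ polygonCount M
fanPolygonCount-zero M = ncSum-ω-translate (λ a → polygonArcs a M) (polygonArcs-shift M) 1

fanPolygonCount-suc : ∀ k r → fanPolygonCount (suc k) (k + r) ≡
                      fanPolygonCount k (k + r) + ω (0 , suc k) * (openPolygonCount k * polygonCount r)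
fanPolygonCount-suc k r = cong (λ n → fanPolygonCount k (k + r) + ω (0 , suc k) * n) (begin
  ncSum ω (fanPolygonArcs 0 k (k + r)) (block (0 , suc k) ∅)
    ≡⟨ ncSum-fanPolygonArcs-split ω 0 k r ⟩
  openPolygonCount k * ncSum ω (polygonArcs (suc k) r) ∅
    ≡⟨ cong (openPolygonCount k *_) (ncSum-ω-translate (λ a → polygonArcs a r) (polygonArcs-shift r) (suc k)) ⟩
  openPolygonCount k * polygonCount r ∎)
  where open ≡-Reasoning

polygonCount-suc : ∀ M → polygonCount (suc M) ≡ (1 + ω (0 , suc M)) * openPolygonCount M
polygonCount-suc M = ncSum-∷-uncrossed ω (0 , suc M) (fanPolygonArcs 0 M M)
  (All.map (λ { {i , j} (_ , _ , j≤1+M) → crossᵇ≡false 0 (suc M) i j z≤n (inj₁ j≤1+M) })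
           (fanPolygonArcs-within 0 M))

isBaseᵇ≡false : ∀ n {i j} → i ≢ 1 ⊎ j ≢ suc n → ((i ≡ᵇ 1) ∧ (j ≡ᵇ suc n)) ≡ false
isBaseᵇ≡false n     (inj₁ i≢1)   rewrite ≢⇒≡ᵇ≡false i≢1   = refl
isBaseᵇ≡false n {i} (inj₂ j≢1+n) rewrite ≢⇒≡ᵇ≡false j≢1+n = ∧-zeroʳ (i ≡ᵇ 1)

colourWeight≡ω : ∀ n {i j} → i ≢ 1 ⊎ j ≢ suc n → colourWeight n (i , j) ≡ ω (i , j)
colourWeight≡ω n {i} {j} i≢1⊎j≢1+n rewrite isBaseᵇ≡false n i≢1⊎j≢1+n with j ≡ᵇ suc i
... | true  = refl
... | false = refl

numBNC≡2*openPolygonCount : ∀ m → numBNC (suc (suc m)) ≡ 2 * openPolygonCount (suc m)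
numBNC≡2*openPolygonCount m = begin
  numBNC n                                     ≡⟨ numBNC≡ncSum m ⟩
  ncSum (colourWeight n) (arcs n) ∅            ≡⟨ ncSum-↭ (colourWeight n) (arcs-↭-polygonArcs n) ∅ ⟩
  ncSum (colourWeight n) (base ∷ Inside) ∅     ≡⟨ ncSum-∷-uncrossed (colourWeight n) base Inside base∦Inside ⟩
  (1 + colourWeight n base) * ncSum (colourWeight n) Inside ∅
    ≡⟨ cong₂ (λ b c → (1 + b) * c) baseWeight (ncSum-congʷ Inside weights) ⟩
  2 * ncSum ω Inside ∅
    ≡⟨ cong (2 *_) (ncSum-ω-translate (λ a → fanPolygonArcs a (suc m) (suc m)) (fanPolygonArcs-shift (suc m) (suc m)) 1) ⟩
  2 * openPolygonCount (suc m) ∎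
  where
  open ≡-Reasoning
  n      = suc (suc m)
  base   = (1 , suc n)
  Inside = fanPolygonArcs 1 (suc m) (suc m)
  base∦Inside : All (λ x → crossᵇ base x ≡ false) Inside
  base∦Inside = All.map (λ { {i , j} (1≤i , _ , j≤1+n) → crossᵇ≡false 1 (suc n) i j 1≤i (inj₁ j≤1+n) })
                        (fanPolygonArcs-within 1 (suc m))
  baseWeight : colourWeight n base ≡ 1
  baseWeight rewrite ≡ᵇ-refl m = refl
  weights : All (λ x → colourWeight n x ≡ ω x) Inside
  weights = ++⁺ (All.map (λ { {i , j} (_ , _ , j≤n) → colourWeight≡ω n {i} (inj₂ (<⇒≢ (s≤s j≤n))) })
                         (fan-within 1 (suc m)))
                (All.map (λ { {i , j} (2≤i , _ , _) → colourWeight≡ω n {j = j} (inj₁ (>⇒≢ 2≤i)) })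
                         (polygonArcs-within 2 (suc m)))

-- The coefficient recurrence for F

∑< : ℕ → (ℕ → ℕ) → ℕ
∑< zero    g = 0
∑< (suc k) g = ∑< k g + g k

∑<-cong : ∀ k {g h : ℕ → ℕ} → (∀ j → j < k → g j ≡ h j) → ∑< k g ≡ ∑< k h
∑<-cong zero    g≗h = refl
∑<-cong (suc k) g≗h = cong₂ _+_ (∑<-cong k λ j j<k → g≗h j (m<n⇒m<1+n j<k)) (g≗h k ≤-refl)

∑<-+ : ∀ k (g h : ℕ → ℕ) → ∑< k (λ j → g j + h j) ≡ ∑< k g + ∑< k h
∑<-+ zero    g h = refl
∑<-+ (suc k) g h rewrite ∑<-+ k g h = ar (∑< k g) (∑< k h) (g k) (h k)
  where ar : ∀ a b c d → a + b + (c + d) ≡ a + c + (b + d)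
        ar = solve-∀

∑<-*ˡ : ∀ k c (g : ℕ → ℕ) → ∑< k (λ j → c * g j) ≡ c * ∑< k g
∑<-*ˡ zero    c g = sym (*-zeroʳ c)
∑<-*ˡ (suc k) c g rewrite ∑<-*ˡ k c g = sym (*-distribˡ-+ c (∑< k g) (g k))

∑<-suc : ∀ k (g : ℕ → ℕ) → ∑< (suc k) g ≡ g 0 + ∑< k (g ∘ suc)
∑<-suc zero    g = +-comm 0 (g 0)
∑<-suc (suc k) g rewrite ∑<-suc k g = +-assoc (g 0) (∑< k (g ∘ suc)) (g (suc k))

∑<-last : ∀ k (g : ℕ → ℕ) → (∀ j → j < k → g j ≡ 0) → ∑< (suc k) g ≡ g k
∑<-last k g vanish = cong (_+ g k) (trans (∑<-cong k vanish) (zeros k))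
  where zeros : ∀ k → ∑< k (λ _ → 0) ≡ 0
        zeros zero    = refl
        zeros (suc k) = trans (+-identityʳ _) (zeros k)

numBNC-suc : ∀ j → numBNC (suc j) ≡ ω (0 , suc j) * openPolygonCount j
numBNC-suc zero    = refl
numBNC-suc (suc m) = numBNC≡2*openPolygonCount m

fanPolygonCount-∑ : ∀ k r M → M ≡ k + r →
  fanPolygonCount k M ≡ polygonCount M + ∑< k (λ j → numBNC (suc j) * polygonCount (M ∸ j))
fanPolygonCount-∑ zero    r M refl = trans (fanPolygonCount-zero M) (sym (+-identityʳ _))
fanPolygonCount-∑ (suc k) r M M≡ = begin
  fanPolygonCount (suc k) M
    ≡⟨ subst (λ M → fanPolygonCount (suc k) M ≡ fanPolygonCount k M + _) (sym M≡k+1+r)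
             (fanPolygonCount-suc k (suc r)) ⟩
  fanPolygonCount k M + ω (0 , suc k) * (openPolygonCount k * polygonCount (suc r))
    ≡⟨ cong₂ _+_ (fanPolygonCount-∑ k (suc r) M M≡k+1+r) (sym (*-assoc (ω (0 , suc k)) (openPolygonCount k) _)) ⟩
  polygonCount M + ∑< k (λ j → numBNC (suc j) * polygonCount (M ∸ j))
    + ω (0 , suc k) * openPolygonCount k * polygonCount (suc r)
    ≡⟨ cong₂ (λ x y → polygonCount M + ∑< k (λ j → numBNC (suc j) * polygonCount (M ∸ j)) + x * polygonCount y)
             (sym (numBNC-suc k)) (sym (trans (cong (_∸ k) M≡k+1+r) (m+n∸m≡n k (suc r)))) ⟩
  polygonCount M + ∑< k (λ j → numBNC (suc j) * polygonCount (M ∸ j)) + numBNC (suc k) * polygonCount (M ∸ k)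
    ≡⟨ +-assoc (polygonCount M) _ _ ⟩
  polygonCount M + ∑< (suc k) (λ j → numBNC (suc j) * polygonCount (M ∸ j)) ∎
  where
  open ≡-Reasoning
  M≡k+1+r = trans M≡ (sym (+-suc k r))

openPolygonCount-∑ : ∀ M → openPolygonCount M ≡ polygonCount M + ∑< M (λ j → numBNC (suc j) * polygonCount (M ∸ j))
openPolygonCount-∑ M = fanPolygonCount-∑ M 0 M (sym (+-identityʳ M))

-- Coefficients of 2 + t; the base of the polygon is an edge for M = 1 and absent for M = 0.
correction : ℕ → ℕ
correction zero          = 2
correction (suc zero)    = 1
correction (suc (suc _)) = 0

2*polygonCount : ∀ m → 2 * polygonCount m ≡ 3 * numBNC m + correction m
2*polygonCount zero          = refl
2*polygonCount (suc zero)    = refl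
2*polygonCount (suc (suc m)) rewrite polygonCount-suc (suc m) | numBNC≡2*openPolygonCount m =
  ar (openPolygonCount (suc m))
  where ar : ∀ x → 2 * (3 * x) ≡ 3 * (2 * x) + 0
        ar = solve-∀

∑<-*correction : ∀ M (g : ℕ → ℕ) → ∑< (suc M) (λ j → g j * correction (suc M ∸ j)) ≡ g M
∑<-*correction M g = begin
  ∑< (suc M) (λ j → g j * correction (suc M ∸ j)) ≡⟨ ∑<-last M _ (λ j j<M → trans (cong (g j *_) (vanish M j j<M)) (*-zeroʳ (g j))) ⟩
  g M * correction (suc M ∸ M)                    ≡⟨ cong (λ i → g M * correction i) (m+n∸n≡m 1 M) ⟩
  g M * 1                                         ≡⟨ *-identityʳ (g M) ⟩
  g M                                             ∎
  where
  open ≡-Reasoning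
  vanish : ∀ M j → j < M → correction (suc M ∸ j) ≡ 0
  vanish (suc M) zero    _         = refl
  vanish (suc M) (suc j) (s≤s j<M) = vanish M j j<M

δ₁ δ₂ : ℕ → ℕ
δ₁ n = if n ≡ᵇ 1 then 1 else 0
δ₂ n = if n ≡ᵇ 2 then 1 else 0

numBNC⁻ : ℕ → ℕ
numBNC⁻ zero    = 0
numBNC⁻ (suc n) = numBNC n

selfConvolution : ℕ → ℕ
selfConvolution n = ∑< (suc n) (λ i → numBNC i * numBNC (n ∸ i))

selfConvolution-suc : ∀ M → selfConvolution (suc M) ≡ ∑< M (λ j → numBNC (suc j) * numBNC (M ∸ j))
selfConvolution-suc M = begin
  ∑< (suc (suc M)) (λ i → numBNC i * numBNC (suc M ∸ i))
    ≡⟨ ∑<-suc (suc M) _ ⟩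
  ∑< M (λ j → numBNC (suc j) * numBNC (M ∸ j)) + numBNC (suc M) * numBNC (M ∸ M)
    ≡⟨ cong (λ i → ∑< M (λ j → numBNC (suc j) * numBNC (M ∸ j)) + numBNC (suc M) * numBNC i) (n∸n≡0 M) ⟩
  ∑< M (λ j → numBNC (suc j) * numBNC (M ∸ j)) + numBNC (suc M) * 0
    ≡⟨ cong₂ _+_ refl (*-zeroʳ (numBNC (suc M))) ⟩
  ∑< M (λ j → numBNC (suc j) * numBNC (M ∸ j)) + 0
    ≡⟨ +-identityʳ _ ⟩
  ∑< M (λ j → numBNC (suc j) * numBNC (M ∸ j)) ∎
  where open ≡-Reasoning

2*openPolygonCount : ∀ M′ → let M = suc M′ in
  2 * openPolygonCount M ≡ correction M + 4 * numBNC M + 3 * selfConvolution (suc M)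
2*openPolygonCount M′ = begin
  2 * openPolygonCount M
    ≡⟨ cong (2 *_) (openPolygonCount-∑ M) ⟩
  2 * (polygonCount M + ∑< M (λ j → f (suc j) * polygonCount (M ∸ j)))
    ≡⟨ trans (*-distribˡ-+ 2 (polygonCount M) _) (cong (λ s → 2 * polygonCount M + s) (sym (∑<-*ˡ M 2 _))) ⟩
  2 * polygonCount M + ∑< M (λ j → 2 * (f (suc j) * polygonCount (M ∸ j)))
    ≡⟨ cong₂ _+_ (2*polygonCount M)
                 (∑<-cong M λ j _ → doubled (f (suc j)) (polygonCount (M ∸ j)) (2*polygonCount (M ∸ j))) ⟩
  3 * f M + correction M + ∑< M (λ j → 3 * (f (suc j) * f (M ∸ j)) + f (suc j) * correction (M ∸ j))
    ≡⟨ cong (λ s → 3 * f M + correction M + s)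
            (trans (∑<-+ M _ _) (cong₂ _+_ (∑<-*ˡ M 3 _) (∑<-*correction M′ (f ∘ suc)))) ⟩
  3 * f M + correction M + (3 * ∑< M (λ j → f (suc j) * f (M ∸ j)) + f M)
    ≡⟨ cong (λ c → 3 * f M + correction M + (3 * c + f M)) (sym (selfConvolution-suc M)) ⟩
  3 * f M + correction M + (3 * selfConvolution (suc M) + f M)
    ≡⟨ ar (f M) (correction M) (selfConvolution (suc M)) ⟩
  correction M + 4 * f M + 3 * selfConvolution (suc M) ∎
  where
  open ≡-Reasoning
  f = numBNC
  M = suc M′
  doubled : ∀ a p {x c} → 2 * p ≡ 3 * x + c → 2 * (a * p) ≡ 3 * (a * x) + a * c
  doubled a p {x} {c} 2p≡ = begin
    2 * (a * p)         ≡⟨ ar₁ a p ⟩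
    a * (2 * p)         ≡⟨ cong (a *_) 2p≡ ⟩
    a * (3 * x + c)     ≡⟨ ar₂ a x c ⟩
    3 * (a * x) + a * c ∎
    where ar₁ : ∀ a p → 2 * (a * p) ≡ a * (2 * p)
          ar₁ = solve-∀
          ar₂ : ∀ a x c → a * (3 * x + c) ≡ 3 * (a * x) + a * c
          ar₂ = solve-∀
  ar : ∀ x c s → 3 * x + c + (3 * s + x) ≡ c + 4 * x + 3 * s
  ar = solve-∀

numBNC-recurrence : ∀ n → numBNC n ≡ δ₁ n + δ₂ n + 4 * numBNC⁻ n + 3 * selfConvolution n
numBNC-recurrence zero           = refl
numBNC-recurrence (suc zero)     = refl
numBNC-recurrence (suc (suc M′)) =
  trans (numBNC-suc (suc M′))
        (trans (2*openPolygonCount M′)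
               (cong (λ c → c + 4 * numBNC (suc M′) + 3 * selfConvolution (suc (suc M′))) (correction≡δ₂ M′)))
  where
  correction≡δ₂ : ∀ m → correction (suc m) ≡ δ₂ (suc (suc m))
  correction≡δ₂ zero    = refl
  correction≡δ₂ (suc m) = refl

sumTo-cong : ∀ n {g h : ℕ → ℤ} → (∀ i → g i ≡ h i) → sumTo n g ≡ sumTo n h
sumTo-cong zero    g≗h = g≗h 0
sumTo-cong (suc n) g≗h = cong₂ ℤ._+_ (sumTo-cong n g≗h) (g≗h (suc n))

sumTo-*ˡ : ∀ n c (g : ℕ → ℤ) → sumTo n (λ i → c ℤ.* g i) ≡ c ℤ.* sumTo n g
sumTo-*ˡ zero    c g = refl
sumTo-*ˡ (suc n) c g rewrite sumTo-*ˡ n c g = sym (ℤ.*-distribˡ-+ c (sumTo n g) (g (suc n)))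

sumTo-+ : ∀ n (g h : ℕ → ℤ) → sumTo n (λ i → g i ℤ.+ h i) ≡ sumTo n g ℤ.+ sumTo n h
sumTo-+ zero    g h = refl
sumTo-+ (suc n) g h rewrite sumTo-+ n g h = ar (sumTo n g) (sumTo n h) (g (suc n)) (h (suc n))
  where ar : ∀ a b c d → a ℤ.+ b ℤ.+ (c ℤ.+ d) ≡ a ℤ.+ c ℤ.+ (b ℤ.+ d)
        ar = ℤ-Solver.solve-∀

sumTo-+ℕ : ∀ n (g : ℕ → ℕ) → sumTo n (λ i → + g i) ≡ + ∑< (suc n) g
sumTo-+ℕ zero    g = refl
sumTo-+ℕ (suc n) g = cong (ℤ._+ + g (suc n)) (sumTo-+ℕ n g)

⊛-congˡ : ∀ {f f′} g n → (∀ i → f i ≡ f′ i) → (f ⊛ g) n ≡ (f′ ⊛ g) n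
⊛-congˡ g n f≗f′ = sumTo-cong n λ i → cong (ℤ._* g (n ∸ i)) (f≗f′ i)

const-⊛ : ∀ a g n → (const a ⊛ g) n ≡ a ℤ.* g n
const-⊛ a g n = go n
  where
  go : ∀ k → sumTo k (λ i → const a i ℤ.* g (n ∸ i)) ≡ a ℤ.* g n
  go zero    = refl
  go (suc k) = trans (cong (ℤ._+ 0ℤ ℤ.* g (n ∸ suc k)) (go k)) (ℤ.+-identityʳ (a ℤ.* g n))

t-⊛-suc : ∀ g n → (t ⊛ g) (suc n) ≡ g n
t-⊛-suc g n = go n
  where
  go : ∀ k → sumTo (suc k) (λ i → t i ℤ.* g (suc n ∸ i)) ≡ g n
  go zero    = trans (ℤ.+-identityˡ (1ℤ ℤ.* g n)) (ℤ.*-identityˡ (g n))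
  go (suc k) = trans (cong (ℤ._+ 0ℤ ℤ.* g (n ∸ suc k)) (go k)) (ℤ.+-identityʳ (g n))

scaled-⊛ : ∀ a f g n → ((const a ⊛ f) ⊛ g) n ≡ a ℤ.* (f ⊛ g) n
scaled-⊛ a f g n = begin
  ((const a ⊛ f) ⊛ g) n                          ≡⟨ ⊛-congˡ g n (const-⊛ a f) ⟩
  sumTo n (λ i → a ℤ.* f i ℤ.* g (n ∸ i))        ≡⟨ sumTo-cong n (λ i → ℤ.*-assoc a (f i) (g (n ∸ i))) ⟩
  sumTo n (λ i → a ℤ.* (f i ℤ.* g (n ∸ i)))      ≡⟨ sumTo-*ˡ n a _ ⟩
  a ℤ.* (f ⊛ g) n                                ∎
  where open ≡-Reasoning

⊖-⊛ : ∀ f g h n → ((f ⊖ g) ⊛ h) n ≡ (f ⊛ h) n ℤ.- (g ⊛ h) n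
⊖-⊛ f g h n = begin
  sumTo n (λ i → (f i ℤ.- g i) ℤ.* h (n ∸ i))
    ≡⟨ sumTo-cong n (λ i → ar (f i) (g i) (h (n ∸ i))) ⟩
  sumTo n (λ i → f i ℤ.* h (n ∸ i) ℤ.+ ℤ.-1ℤ ℤ.* (g i ℤ.* h (n ∸ i)))
    ≡⟨ trans (sumTo-+ n (λ i → f i ℤ.* h (n ∸ i)) (λ i → ℤ.-1ℤ ℤ.* (g i ℤ.* h (n ∸ i))))
             (cong (λ x → (f ⊛ h) n ℤ.+ x) (sumTo-*ˡ n ℤ.-1ℤ _)) ⟩
  (f ⊛ h) n ℤ.+ ℤ.-1ℤ ℤ.* (g ⊛ h) n
    ≡⟨ cong (λ x → (f ⊛ h) n ℤ.+ x) (ℤ.-1*i≡-i ((g ⊛ h) n)) ⟩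
  (f ⊛ h) n ℤ.- (g ⊛ h) n ∎
  where
  open ≡-Reasoning
  ar : ∀ a b c → (a ℤ.- b) ℤ.* c ≡ a ℤ.* c ℤ.+ ℤ.-1ℤ ℤ.* (b ℤ.* c)
  ar = ℤ-Solver.solve-∀

t≡δ₁ : ∀ n → t n ≡ + δ₁ n
t≡δ₁ zero          = refl
t≡δ₁ (suc zero)    = refl
t≡δ₁ (suc (suc n)) = refl

t⊛t≡δ₂ : ∀ n → (t ⊛ t) n ≡ + δ₂ n
t⊛t≡δ₂ zero    = refl
t⊛t≡δ₂ (suc n) = trans (t-⊛-suc t n) (t≡δ₂∘suc n)
  where
  t≡δ₂∘suc : ∀ n → t n ≡ + δ₂ (suc n)
  t≡δ₂∘suc zero          = refl
  t≡δ₂∘suc (suc zero)    = refl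
  t≡δ₂∘suc (suc (suc n)) = refl

t⊛F≡numBNC⁻ : ∀ n → (t ⊛ F) n ≡ + numBNC⁻ n
t⊛F≡numBNC⁻ zero    = refl
t⊛F≡numBNC⁻ (suc n) = t-⊛-suc F n

F⊛F≡selfConvolution : ∀ n → (F ⊛ F) n ≡ + selfConvolution n
F⊛F≡selfConvolution n = trans (sumTo-cong n λ i → sym (ℤ.pos-* (numBNC i) (numBNC (n ∸ i))))
                               (sumTo-+ℕ n (λ i → numBNC i * numBNC (n ∸ i)))

F-coefficient : ∀ n → F n ≡ + δ₁ n ℤ.+ + δ₂ n ℤ.+ + 4 ℤ.* + numBNC⁻ n ℤ.+ + 3 ℤ.* + selfConvolution n
F-coefficient n = trans (cong +_ (numBNC-recurrence n))
             (cong₂ ℤ._+_ (cong (λ x → + δ₁ n ℤ.+ + δ₂ n ℤ.+ x) (ℤ.pos-* 4 (numBNC⁻ n)))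
                          (ℤ.pos-* 3 (selfConvolution n)))

linear-coefficient : ∀ n → ((const 1ℤ ⊖ const (+ 4) ⊛ t) ⊛ F) n ≡ F n ℤ.- + 4 ℤ.* + numBNC⁻ n
linear-coefficient n = begin
  ((const 1ℤ ⊖ const (+ 4) ⊛ t) ⊛ F) n
    ≡⟨ ⊖-⊛ (const 1ℤ) (const (+ 4) ⊛ t) F n ⟩
  (const 1ℤ ⊛ F) n ℤ.- ((const (+ 4) ⊛ t) ⊛ F) n
    ≡⟨ cong₂ ℤ._-_ (trans (const-⊛ 1ℤ F n) (ℤ.*-identityˡ (F n)))
                   (trans (scaled-⊛ (+ 4) t F n) (cong (+ 4 ℤ.*_) (t⊛F≡numBNC⁻ n))) ⟩
  F n ℤ.- + 4 ℤ.* + numBNC⁻ n ∎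
  where open ≡-Reasoning

quadratic-coefficient : ∀ n → ((const (+ 3) ⊛ F) ⊛ F) n ≡ + 3 ℤ.* + selfConvolution n
quadratic-coefficient n = trans (scaled-⊛ (+ 3) F F n) (cong (+ 3 ℤ.*_) (F⊛F≡selfConvolution n))

mainTheorem10 : ∀ (n : ℕ) →
    (⊝ t ⊖ t ⊛ t ⊕ (const 1ℤ ⊖ const (+ 4) ⊛ t) ⊛ F ⊖ const (+ 3) ⊛ F ⊛ F) n ≡ 0ℤ
mainTheorem10 n = begin
  ℤ.- t n ℤ.- (t ⊛ t) n ℤ.+ ((const 1ℤ ⊖ const (+ 4) ⊛ t) ⊛ F) n ℤ.- ((const (+ 3) ⊛ F) ⊛ F) n
    ≡⟨ cong₂ ℤ._-_ (cong₂ ℤ._+_ (cong₂ ℤ._-_ (cong ℤ.-_ (t≡δ₁ n)) (t⊛t≡δ₂ n)) (linear-coefficient n))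
                   (quadratic-coefficient n) ⟩
  ℤ.- a ℤ.- b ℤ.+ (F n ℤ.- + 4 ℤ.* p) ℤ.- + 3 ℤ.* c
    ≡⟨ cong (λ f → ℤ.- a ℤ.- b ℤ.+ (f ℤ.- + 4 ℤ.* p) ℤ.- + 3 ℤ.* c) (F-coefficient n) ⟩
  ℤ.- a ℤ.- b ℤ.+ ((a ℤ.+ b ℤ.+ + 4 ℤ.* p ℤ.+ + 3 ℤ.* c) ℤ.- + 4 ℤ.* p) ℤ.- + 3 ℤ.* c
    ≡⟨ cancel a b p c ⟩
  0ℤ ∎
  where
  open ≡-Reasoning
  a = + δ₁ n
  b = + δ₂ n
  p = + numBNC⁻ n
  c = + selfConvolution n
  cancel : ∀ a b p c → ℤ.- a ℤ.- b ℤ.+ ((a ℤ.+ b ℤ.+ + 4 ℤ.* p ℤ.+ + 3 ℤ.* c) ℤ.- + 4 ℤ.* p) ℤ.- + 3 ℤ.* c ≡ 0ℤ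
  cancel = ℤ-Solver.solve-∀
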